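{- Let $\mathbf{u}$ be a standard episturmian sequence over a finite alphabet $\mathcal A$, and let $v=v_0v_1\cdots v_{|v|-1}$ be a non-empty prefix of $\mathbf{u}$ that is a palindrome. For every letter $a$ occurring in $v$, let $$m_a=\max\{|p| \,:\, p \text{ is a palindrome and } pa \text{ is a prefix of } v\}.$$ Then $\Gamma=\{m_a : a \text{ occurs in } v\}$ is a string attractor of $v$, and it has the minimal possible size among string attractors of $v$.
   Context: A sequence is an infinite word $\mathbf{u}=u_0u_1u_2\cdots$ over a finite alphabet $\mathcal A$. A factor of $\mathbf{u}$ is a finite word $u_iu_{i+1}\cdots u_{j-1}$ ($i\le j$); the language $\mathcal L(\mathbf{u})$ is the set of all factors. For a word $w=w_0\cdots w_{n-1}$, $\overline{w}=w_{n-1}\cdots w_0$ is its reversal; $w$ is a palindrome if $w=\overline{w}$ (the empty word is a palindrome). The language is closed under reversal if $w\in\mathcal L(\mathbf{u})$ implies $\overline{w}\in\mathcal L(\mathbf{u})$. A factor $w$ is left special if $aw,bw\in\mathcal L(\mathbf{u})$ for two distinct letters $a,b$. A sequence $\mathbf{u}$ is episturmian if its language is closed under reversal and for each length $n$ it has at most one left special factor of length $n$; it is standard episturmian if moreover all its left special factors are prefixes of $\mathbf{u}$. Positions in a finite word are indexed from $0$. A string attractor of a finite word $w=w_0\cdots w_{n-1}$ is a set $\Gamma\subseteq\{0,1,\dots,n-1\}$ such that every factor of $w$ has an occurrence $w_iw_{i+1}\cdots w_{j-1}$ (occupying the positions $\{i,\dots,j-1\}$) with $\{i,\dots,j-1\}\cap\Gamma\neq\emptyset$.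 -}

module Defs where

open import Data.Nat using (ℕ; zero; suc; _+_; _≤_; _<_; _⊔_; _≟_)
open import Data.Fin using (Fin; toℕ)
import Data.Fin as Fin
open import Data.Bool using (Bool; true; false; _∧_; if_then_else_)
open import Data.List using (List; []; _∷_; _++_; [_]; length; reverse; take; drop; map; foldr; upTo)
open import Data.Bool.ListAction using (any)
open import Data.List.Properties using (≡-dec)
open import Data.Fin.Subset using (Subset; _∈_; ∣_∣)
open import Data.Vec using (tabulate)
open import Data.Product using (Σ; ∃; _×_; _,_)
open import Relation.Nullary using (¬_; Dec; does)
open import Relation.Binary.PropositionalEquality using (_≡_; _≢_)

Word : ℕ → Set
Word k = List (Fin k)

Seq : ℕ → Set
Seq k = ℕ → Fin k

slice : ∀ {k} → Seq k → ℕ → ℕ → Word k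
slice u i zero = []
slice u i (suc n) = u i ∷ slice u (suc i) n

InL : ∀ {k} → Seq k → Word k → Set
InL u w = ∃ λ i → slice u i (length w) ≡ w

IsPrefixOfSeq : ∀ {k} → Word k → Seq k → Set
IsPrefixOfSeq v u = slice u 0 (length v) ≡ v

IsPalindrome : ∀ {k} → Word k → Set
IsPalindrome w = reverse w ≡ w

ClosedUnderReversal : ∀ {k} → Seq k → Set
ClosedUnderReversal u = ∀ w → InL u w → InL u (reverse w)

LeftSpecial : ∀ {k} → Seq k → Word k → Set
LeftSpecial u w = Σ _ λ a → Σ _ λ b → a ≢ b × InL u (a ∷ w) × InL u (b ∷ w)

Episturmian : ∀ {k} → Seq k → Set
Episturmian u =
  ClosedUnderReversal u ×
  (∀ w w' → length w ≡ length w' → LeftSpecial u w → LeftSpecial u w' → w ≡ w')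

StandardEpisturmian : ∀ {k} → Seq k → Set
StandardEpisturmian u =
  Episturmian u × (∀ w → LeftSpecial u w → IsPrefixOfSeq w u)

sub : ∀ {k} → Word k → ℕ → ℕ → Word k
sub v i l = take l (drop i v)

IsStringAttractor : ∀ {k} (v : Word k) → Subset (length v) → Set
IsStringAttractor v Γ =
  ∀ i l → 1 ≤ l → i + l ≤ length v →
    ∃ λ i' → i' + l ≤ length v × sub v i' l ≡ sub v i l ×
      (∃ λ (p : Fin (length v)) → p ∈ Γ × i' ≤ toℕ p × toℕ p < i' + l)

_≟w_ : ∀ {k} (x y : Word k) → Dec (x ≡ y)
_≟w_ = ≡-dec Fin._≟_

-- m_a = max { |p| : p palindrome, p a a prefix of v }  (0 if the set is empty)
-- candidate j: j if the prefix of length j is a palindrome followed by a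
mCand : ∀ {k} → Word k → Fin k → ℕ → ℕ
mCand v a j =
  if does (take (suc j) v ≟w (take j v ++ [ a ])) ∧ does (reverse (take j v) ≟w take j v)
  then j else 0

m : ∀ {k} → Word k → Fin k → ℕ
m v a = foldr _⊔_ 0 (map (mCand v a) (upTo (length v)))

Γ : ∀ {k} (v : Word k) → Subset (length v)
Γ v = tabulate (λ p → any (λ a → does (m v a ≟ toℕ p)) v)

-- In a standard episturmian sequence every palindromic prefix is obtained from the previous one by
-- palindromic closure: if T is a palindromic prefix length, the next one is T + 1 + X, where u_X ⋯ u_T
-- is the longest palindromic suffix of u₀ ⋯ u_T: extending that suffix symmetrically never fails, since
-- a mismatch would make the central palindrome left special, hence a prefix, and this yields a longer
-- palindromic suffix. Consequently, if S is the first palindromic prefix after T followed by the same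
-- letter as T, the next palindromic prefix after S has length 2S − T (Justin's formula).
--
-- Given an occurrence of a factor of v, reflect it inside palindromic prefixes until it covers the
-- end T of a palindromic prefix while lying inside the next one. Then, with a = u_T, repeatedly shift
-- it by S − T, a period of the palindromic prefix after S, where S is the next palindromic prefix
-- followed by a; this ends at m_a, so every factor has an occurrence covering Γ. Conversely an
-- attractor contains an occurrence of every letter a of v, which is mapped to m_a, so |Γ| is minimal.

module Submission where

open import Defs
open import Data.Bool using (true; false)
open import Data.Bool.Properties using (T-≡)
open import Data.Empty using (⊥-elim)
open import Data.Fin using (Fin; toℕ; fromℕ<)
import Data.Fin as Fin
open import Data.Fin.Properties using (toℕ<n; toℕ-fromℕ<)
open import Data.Fin.Subset using (Subset; _∈_; ∣_∣)
open import Data.List using (List; []; _∷_; _++_; [_]; length; reverse; take; drop; map; foldr; upTo)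
open import Data.List.Properties using (∷-injective; ∷-injectiveˡ; ∷ʳ-injectiveʳ; reverse-++)
open import Data.List.Membership.Propositional using (find; lose) renaming (_∈_ to _∈ₗ_)
open import Data.List.Membership.Propositional.Properties using (∈-map⁺; ∈-map⁻; ∈-upTo⁺; ∈-upTo⁻)
open import Data.List.Relation.Unary.Any using (here; there)
open import Data.List.Relation.Unary.Any.Properties using (any⁺; any⁻)
open import Data.Nat using (ℕ; zero; suc; _+_; _∸_; _≤_; _<_; _⊔_; z≤n; s≤s; z<s; _≟_; _≤?_; _<?_)
open import Data.Nat.Induction using (<-wellFounded)
open import Data.Nat.Properties
open import Data.Nat.Tactic.RingSolver using (solve)
open import Data.Product using (∃; _×_; _,_; proj₁; proj₂; uncurry)
open import Data.Sum using (_⊎_; inj₁; inj₂; [_,_]′)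
import Data.Vec as Vec
open import Data.Vec.Properties using (lookup∘tabulate; lookup⇒[]=; []=⇒lookup)
open import Function using (_∘_; case_of_)
open import Function.Bundles using (_⇔_; mk⇔; Equivalence)
open import Induction.WellFounded using (Acc; acc)
open import Relation.Nullary using (¬_; Dec; yes; no)
open import Relation.Nullary.Decidable using (map′; _×-dec_; dec-true)
open import Relation.Binary.PropositionalEquality hiding ([_])

module BoundedSearch {P : ℕ → Set} (P? : ∀ n → Dec (P n)) where

  greatest : ∀ N {j} → j ≤ N → P j →
             ∃ λ g → g ≤ N × P g × (∀ {j'} → j' ≤ N → P j' → j' ≤ g)
  greatest zero z≤n pj = 0 , z≤n , pj , λ { z≤n _ → z≤n }
  greatest (suc N) j≤ pj with P? (suc N)
  ... | yes p = suc N , ≤-refl , p , λ le _ → le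
  ... | no ¬p =
    let g , g≤N , pg , maximal = greatest N (below j≤ pj) pj
    in g , m≤n⇒m≤1+n g≤N , pg , λ le pj' → maximal (below le pj') pj'
    where
      below : ∀ {j} → j ≤ suc N → P j → j ≤ N
      below le pj with m≤n⇒m<n∨m≡n le
      ... | inj₁ lt = ≤-pred lt
      ... | inj₂ refl = ⊥-elim (¬p pj)

  leastBelow : ∀ N → (∃ λ g → g < N × P g × (∀ {j} → j < g → ¬ P j)) ⊎ (∀ {j} → j < N → ¬ P j)
  leastBelow zero = inj₂ λ ()
  leastBelow (suc N) with leastBelow N
  ... | inj₁ (g , g<N , pg , minimal) = inj₁ (g , m≤n⇒m≤1+n g<N , pg , minimal)
  ... | inj₂ none with P? N
  ...   | yes p = inj₁ (N , ≤-refl , p , none)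
  ...   | no ¬p = inj₂ λ lt → [ none , (λ { refl → ¬p }) ]′ (m≤n⇒m<n∨m≡n (≤-pred lt))

  least : ∀ {j} → P j → ∃ λ g → P g × g ≤ j × (∀ {j'} → j' < g → ¬ P j')
  least {j} pj with leastBelow (suc j)
  ... | inj₁ (g , g<sj , pg , minimal) = g , pg , ≤-pred g<sj , minimal
  ... | inj₂ none = ⊥-elim (none ≤-refl pj)

x≤foldr⊔ : ∀ {x} xs → x ∈ₗ xs → x ≤ foldr _⊔_ 0 xs
x≤foldr⊔ (y ∷ xs) (here refl) = m≤m⊔n y _
x≤foldr⊔ (y ∷ xs) (there x∈) = ≤-trans (x≤foldr⊔ xs x∈) (m≤n⊔m y _)

foldr⊔-sel : ∀ xs → foldr _⊔_ 0 xs ≡ 0 ⊎ foldr _⊔_ 0 xs ∈ₗ xs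
foldr⊔-sel [] = inj₁ refl
foldr⊔-sel (x ∷ xs) with ⊔-sel x (foldr _⊔_ 0 xs)
... | inj₁ e = inj₂ (here e)
... | inj₂ e with foldr⊔-sel xs
...   | inj₁ z = inj₁ (trans e z)
...   | inj₂ m∈ = inj₂ (there (subst (_∈ₗ xs) (sym e) m∈))

private
  lower : List ℕ → List ℕ
  lower [] = []
  lower (zero ∷ L) = lower L
  lower (suc x ∷ L) = x ∷ lower L

  ∈-lower : ∀ {x} L → suc x ∈ₗ L → x ∈ₗ lower L
  ∈-lower (zero ∷ L) (there x∈) = ∈-lower L x∈
  ∈-lower (suc y ∷ L) (here refl) = here refl
  ∈-lower (suc y ∷ L) (there x∈) = there (∈-lower L x∈)

  length-lower : ∀ L → length (lower L) ≤ length L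
  length-lower [] = z≤n
  length-lower (zero ∷ L) = m≤n⇒m≤1+n (length-lower L)
  length-lower (suc x ∷ L) = s≤s (length-lower L)

  length-lower-0∈ : ∀ L → 0 ∈ₗ L → length (lower L) < length L
  length-lower-0∈ (zero ∷ L) _ = s≤s (length-lower L)
  length-lower-0∈ (suc x ∷ L) (there 0∈) = s≤s (length-lower-0∈ L 0∈)

card≤length : ∀ {n} (A : Subset n) (L : List ℕ) →
              (∀ {p} → p ∈ A → toℕ p ∈ₗ L) → ∣ A ∣ ≤ length L
card≤length Vec.[] L h = z≤n
card≤length (false Vec.∷ A) L h =
  ≤-trans (card≤length A (lower L) (λ p∈ → ∈-lower L (h (Vec.there p∈)))) (length-lower L)
card≤length (true Vec.∷ A) L h =
  ≤-trans (s≤s (card≤length A (lower L) (λ p∈ → ∈-lower L (h (Vec.there p∈)))))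
          (length-lower-0∈ L (h Vec.here))

image : ∀ {n} → Subset n → (Fin n → ℕ) → List ℕ
image Vec.[] f = []
image (true Vec.∷ S) f = f Fin.zero ∷ image S (f ∘ Fin.suc)
image (false Vec.∷ S) f = image S (f ∘ Fin.suc)

length-image : ∀ {n} (S : Subset n) f → length (image S f) ≡ ∣ S ∣
length-image Vec.[] f = refl
length-image (true Vec.∷ S) f = cong suc (length-image S _)
length-image (false Vec.∷ S) f = length-image S _

∈-image : ∀ {n} (S : Subset n) f {q} → q ∈ S → f q ∈ₗ image S f
∈-image (true Vec.∷ S) f Vec.here = here refl
∈-image (true Vec.∷ S) f (Vec.there q∈) = there (∈-image S _ q∈)
∈-image (false Vec.∷ S) f (Vec.there q∈) = ∈-image S _ q∈

card≤card-image : ∀ {n} (A B : Subset n) (f : Fin n → ℕ) →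
                  (∀ {p} → p ∈ A → ∃ λ q → q ∈ B × f q ≡ toℕ p) → ∣ A ∣ ≤ ∣ B ∣
card≤card-image A B f covers = subst (∣ A ∣ ≤_) (length-image B f) (card≤length A (image B f) inImage)
  where
    inImage : ∀ {p} → p ∈ A → toℕ p ∈ₗ image B f
    inImage p∈ with covers p∈
    ... | q , q∈ , fq = subst (_∈ₗ image B f) fq (∈-image B f q∈)

module _ {k : ℕ} where

  Agree : Seq k → ℕ → Seq k → ℕ → ℕ → Set
  Agree f i g j n = ∀ t → t < n → f (i + t) ≡ g (j + t)

  length-slice : ∀ (f : Seq k) i n → length (slice f i n) ≡ n
  length-slice f i zero = refl
  length-slice f i (suc n) = cong suc (length-slice f (suc i) n)

  slice≡⇒Agree : ∀ f i g j n → slice f i n ≡ slice g j n → Agree f i g j n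
  slice≡⇒Agree f i g j (suc n) e zero _ =
    trans (cong f (+-identityʳ i)) (trans (proj₁ (∷-injective e)) (cong g (sym (+-identityʳ j))))
  slice≡⇒Agree f i g j (suc n) e (suc t) (s≤s t<n) =
    trans (cong f (+-suc i t))
      (trans (slice≡⇒Agree f (suc i) g (suc j) n (proj₂ (∷-injective e)) t t<n) (cong g (sym (+-suc j t))))

  Agree⇒slice≡ : ∀ f i g j n → Agree f i g j n → slice f i n ≡ slice g j n
  Agree⇒slice≡ f i g j zero agree = refl
  Agree⇒slice≡ f i g j (suc n) agree = cong₂ _∷_
    (trans (cong f (sym (+-identityʳ i))) (trans (agree 0 (s≤s z≤n)) (cong g (+-identityʳ j))))
    (Agree⇒slice≡ f (suc i) g (suc j) n λ t t<n →
      trans (cong f (sym (+-suc i t))) (trans (agree (suc t) (s≤s t<n)) (cong g (+-suc j t))))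

  slice-suc : ∀ (f : Seq k) i n → slice f i (suc n) ≡ slice f i n ++ [ f (i + n) ]
  slice-suc f i zero = cong (λ z → [ f z ]) (sym (+-identityʳ i))
  slice-suc f i (suc n) =
    cong (f i ∷_) (trans (slice-suc f (suc i) n) (cong (λ z → slice f (suc i) n ++ [ f z ]) (sym (+-suc i n))))

  reverse-slice : ∀ (f : Seq k) i n → reverse (slice f i (suc n)) ≡ slice (λ t → f (i + (n ∸ t))) 0 (suc n)
  reverse-slice f i zero = cong (λ z → [ f z ]) (sym (+-identityʳ i))
  reverse-slice f i (suc n) = begin
    reverse (slice f i (suc (suc n)))             ≡⟨ cong reverse (slice-suc f i (suc n)) ⟩
    reverse (slice f i (suc n) ++ [ f (i + suc n) ]) ≡⟨ reverse-++ (slice f i (suc n)) [ f (i + suc n) ] ⟩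
    f (i + suc n) ∷ reverse (slice f i (suc n))   ≡⟨ cong (f (i + suc n) ∷_) (reverse-slice f i n) ⟩
    f (i + suc n) ∷ slice (λ t → f (i + (n ∸ t))) 0 (suc n)
      ≡⟨ cong (f (i + suc n) ∷_) (Agree⇒slice≡ _ 0 _ 1 (suc n) (λ t _ → refl)) ⟩
    slice (λ t → f (i + (suc n ∸ t))) 0 (suc (suc n)) ∎
    where open ≡-Reasoning

  take-slice : ∀ (f : Seq k) i l n → take l (slice f i (l + n)) ≡ slice f i l
  take-slice f i zero n = refl
  take-slice f i (suc l) n = cong (f i ∷_) (take-slice f (suc i) l n)

  drop-slice : ∀ (f : Seq k) i d n → drop d (slice f i (d + n)) ≡ slice f (i + d) n
  drop-slice f i zero n = cong (λ z → slice f z n) (sym (+-identityʳ i))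
  drop-slice f i (suc d) n = trans (drop-slice f (suc i) d n) (cong (λ z → slice f z n) (sym (+-suc i d)))

  ∈-slice⁺ : ∀ (f : Seq k) i n {t} → t < n → f (i + t) ∈ₗ slice f i n
  ∈-slice⁺ f i (suc n) {zero} _ = here (cong f (+-identityʳ i))
  ∈-slice⁺ f i (suc n) {suc t} (s≤s t<n) =
    there (subst (λ z → f z ∈ₗ slice f (suc i) n) (sym (+-suc i t)) (∈-slice⁺ f (suc i) n t<n))

  ∈-slice⁻ : ∀ (f : Seq k) i n {a} → a ∈ₗ slice f i n → ∃ λ t → t < n × f (i + t) ≡ a
  ∈-slice⁻ f i (suc n) (here e) = 0 , s≤s z≤n , trans (cong f (+-identityʳ i)) (sym e)
  ∈-slice⁻ f i (suc n) (there a∈) with ∈-slice⁻ f (suc i) n a∈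
  ... | t , t<n , e = suc t , s≤s t<n , trans (cong f (+-suc i t)) e

module Palindromes {k : ℕ} (u : Seq k) where

  PalAt : ℕ → ℕ → Set
  PalAt i n = ∀ r s → suc (r + s) ≡ n → u (i + r) ≡ u (i + s)

  Pal : ℕ → Set
  Pal = PalAt 0

  SameAt : ℕ → ℕ → ℕ → Set
  SameAt i j = Agree u i u j

  SameAt-trans : ∀ {i j h l} → SameAt i j l → SameAt j h l → SameAt i h l
  SameAt-trans ij jh t t<l = trans (ij t t<l) (jh t t<l)

  PalAt⇒reverse : ∀ i n → PalAt i n → reverse (slice u i n) ≡ slice u i n
  PalAt⇒reverse i zero pal = refl
  PalAt⇒reverse i (suc n) pal = trans (reverse-slice u i n) (Agree⇒slice≡ _ 0 u i (suc n) λ t t<sn →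
    pal (n ∸ t) t (cong suc (m∸n+n≡m (≤-pred t<sn))))

  reverse⇒PalAt : ∀ i n → reverse (slice u i n) ≡ slice u i n → PalAt i n
  reverse⇒PalAt i (suc n) rev r s rs≡n =
    trans (cong (λ z → u (i + z)) (sym n∸s≡r))
      (slice≡⇒Agree _ 0 u i (suc n) (trans (sym (reverse-slice u i n)) rev) s s<sn)
    where
      r+s≡n : r + s ≡ n
      r+s≡n = suc-injective rs≡n
      n∸s≡r : n ∸ s ≡ r
      n∸s≡r = trans (cong (_∸ s) (sym r+s≡n)) (m+n∸n≡m r s)
      s<sn : s < suc n
      s<sn = s≤s (subst (s ≤_) r+s≡n (m≤n+m s r))

  PalAt? : ∀ i n → Dec (PalAt i n)
  PalAt? i n = map′ (reverse⇒PalAt i n) (PalAt⇒reverse i n) (reverse (slice u i n) ≟w slice u i n)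

  Pal-0 : Pal 0
  Pal-0 r s ()

  PalAt-1 : ∀ i → PalAt i 1
  PalAt-1 i zero zero _ = refl

  PalAt-fromPositive : ∀ {i n} → (∀ r s → suc (r + suc s) ≡ n → u (i + r) ≡ u (i + suc s)) → PalAt i n
  PalAt-fromPositive h r (suc s) eq = h r s eq
  PalAt-fromPositive h zero zero eq = refl
  PalAt-fromPositive h (suc r) zero eq = sym (h 0 r (trans (cong (λ z → suc (suc z)) (sym (+-identityʳ r))) eq))

  PalAt-extend : ∀ {i n} → PalAt (suc i) n → u i ≡ u (suc i + n) → PalAt i (suc (suc n))
  PalAt-extend {i} {n} pal ends = PalAt-fromPositive λ where
    zero s eq → trans (cong u (+-identityʳ i))
                  (trans ends (cong u (trans (sym (+-suc i n))
                                        (cong (λ z → i + suc z) (sym (suc-injective (suc-injective eq)))))))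
    (suc r) s eq → trans (cong u (+-suc i r))
                     (trans (pal r s (trans (sym (+-suc r s)) (suc-injective (suc-injective eq))))
                            (cong u (sym (+-suc i s))))

  PalAt-transport : ∀ {i j n} → SameAt j i n → PalAt i n → PalAt j n
  PalAt-transport same pal p q pq≡n =
    trans (same p (subst (p <_) pq≡n (s≤s (m≤m+n p q))))
      (trans (pal p q pq≡n) (sym (same q (subst (q <_) pq≡n (s≤s (m≤n+m q p))))))

  PalAt-centre : ∀ {R X n} → Pal R → X + n + X ≡ R → PalAt X n
  PalAt-centre {X = X} palR X+n+X≡R p q pq≡n =
    palR (X + p) (X + q) (trans reassoc (trans (cong (λ z → X + z + X) pq≡n) X+n+X≡R))
    where
      reassoc : suc (X + p + (X + q)) ≡ X + suc (p + q) + X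
      reassoc = solve (X ∷ p ∷ q ∷ [])

  Pal-suffix : ∀ {S T D} → Pal S → Pal T → D + T ≡ S → PalAt D T
  Pal-suffix {S} {T} {D} palS palT D+T≡S p q pq≡T = begin
    u (D + p) ≡⟨ palS (D + p) q (across p q pq≡T) ⟩
    u q       ≡⟨ palT q p (trans (cong suc (+-comm q p)) pq≡T) ⟩
    u p       ≡⟨ sym (palS (D + q) p (across q p (trans (cong suc (+-comm q p)) pq≡T))) ⟩
    u (D + q) ∎
    where
      open ≡-Reasoning
      across : ∀ p q → suc (p + q) ≡ T → suc (D + p + q) ≡ S
      across p q pq≡T = trans reassoc (trans (cong (D +_) pq≡T) D+T≡S)
        where
          reassoc : suc (D + p + q) ≡ D + suc (p + q)
          reassoc = solve (D ∷ p ∷ q ∷ [])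

  Pal-period : ∀ {S D x} → Pal S → Pal (S + D) → x < S → u (x + D) ≡ u x
  Pal-period {D = D} {x} palS palSD x<S with m≤n⇒∃[o]m+o≡n x<S
  ... | y , refl = trans (palSD (x + D) y reassoc) (palS y x (cong suc (+-comm y x)))
    where
      reassoc : suc (x + D + y) ≡ suc x + y + D
      reassoc = solve (x ∷ D ∷ y ∷ [])

  -- A palindromic suffix of u₀ ⋯ u_S of length R + 2 is u_S p u_S with p a palindrome; when
  -- u₀ ⋯ u_{S-1} is a palindrome, mirroring it gives the palindromic prefix p followed by u_S.
  Pal-suffix-mirror : ∀ {S X R} → Pal S → PalAt X (suc (suc R)) → X + suc R ≡ S → Pal R × u R ≡ u S
  Pal-suffix-mirror {S} {X} {R} palS palX X+R≡S = palR , trans (palS R X (mirror-R)) uX≡uS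
    where
      uX≡uS : u X ≡ u S
      uX≡uS = trans (cong u (sym (+-identityʳ X))) (trans (palX 0 (suc R) refl) (cong u X+R≡S))
      mirror-R : suc (R + X) ≡ S
      mirror-R = trans (cong suc (+-comm R X)) (trans (sym (+-suc X R)) X+R≡S)
      palR : Pal R
      palR a b ab≡R = begin
        u a             ≡⟨ palS a (suc X + b) (outer a b ab≡R) ⟩
        u (suc X + b)   ≡⟨ cong u (sym (+-suc X b)) ⟩
        u (X + suc b)   ≡⟨ palX (suc b) (suc a) (cong suc (trans (inner b a) (cong suc ab≡R))) ⟩
        u (X + suc a)   ≡⟨ cong u (+-suc X a) ⟩
        u (suc X + a)   ≡⟨ palS (suc X + a) b (trans (cong suc (+-comm (suc X + a) b)) (outer b a ba≡R)) ⟩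
        u b             ∎
        where
          open ≡-Reasoning
          ba≡R : suc (b + a) ≡ R
          ba≡R = trans (cong suc (+-comm b a)) ab≡R
          outer : ∀ a b → suc (a + b) ≡ R → suc (a + (suc X + b)) ≡ S
          outer a b ab≡R = trans (reassoc a b) (trans (cong (λ z → X + suc z) ab≡R) X+R≡S)
            where
              reassoc : ∀ a b → suc (a + (suc X + b)) ≡ X + suc (suc (a + b))
              reassoc a b = solve (a ∷ X ∷ b ∷ [])
          inner : ∀ b a → suc b + suc a ≡ suc (suc (a + b))
          inner b a = solve (b ∷ a ∷ [])

  mirror-occurrence : ∀ {T E i l} → Pal T → Pal (suc T + E) → E ≤ T → T < i → i + l ≤ suc T + E →
                      ∃ λ i' → i' + suc E ≡ i × SameAt i' i l
  mirror-occurrence {T} {E} {l = l} palT palC E≤T T<i end≤C with m≤n⇒∃[o]m+o≡n (≤-<-trans E≤T T<i)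
  ... | i' , refl = i' , +-comm i' (suc E) , mirrored
    where
      i'+l≤T : i' + l ≤ T
      i'+l≤T = +-cancelˡ-≤ (suc E) (i' + l) T (subst₂ _≤_ (+-assoc (suc E) i' l) (cong suc (+-comm T E)) end≤C)
      mirrored : SameAt i' (suc E + i') l
      mirrored t t<l with m≤n⇒∃[o]m+o≡n (<-≤-trans (+-monoʳ-< i' t<l) i'+l≤T)
      ... | y , i't+y≡T =
        trans (palT (i' + t) y i't+y≡T) (palC y (suc E + i' + t) (trans reassoc (cong (λ z → suc (z + E)) i't+y≡T)))
        where
          reassoc : suc (y + (suc E + i' + t)) ≡ suc (suc (i' + t) + y + E)
          reassoc = solve (y ∷ E ∷ i' ∷ t ∷ [])

  shift-occurrence : ∀ {T S D i l} → Pal S → Pal (S + D) → T + D ≡ S → i ≤ T → T < i + l → i + l ≤ S →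
                     i + D ≤ S × S < i + D + l × i + D + l ≤ S + D × SameAt (i + D) i l
  shift-occurrence {S = S} {D} {i} {l} palS palSD T+D≡S i≤T T<i+l i+l≤S =
    subst (i + D ≤_) T+D≡S (+-monoˡ-≤ D i≤T) ,
    subst₂ _<_ T+D≡S (sym (swap l)) (+-monoˡ-< D T<i+l) ,
    subst (_≤ S + D) (sym (swap l)) (+-monoˡ-≤ D i+l≤S) ,
    λ t t<l → trans (cong u (swap t)) (Pal-period palS palSD (<-≤-trans (+-monoʳ-< i t<l) i+l≤S))
    where
      swap : ∀ t → i + D + t ≡ i + t + D
      swap t = solve (i ∷ D ∷ t ∷ [])

  Next : ℕ → ℕ → Set
  Next T c = Pal c × T < c × (∀ {R} → Pal R → T < R → c ≤ R)

  Straddles : ℕ → ℕ → ℕ → Set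
  Straddles T i l = Pal T × (∃ λ c → Next T c × i + l ≤ c) × i ≤ T × T < i + l

module StandardEpisturmianPalindromes {k : ℕ} (u : Seq k) (std : StandardEpisturmian u) where
  open Palindromes u

  -- u_s w and, by closure under reversal, u_{s+1+n} w are factors, so w is left special.
  distinct-neighbours⇒prefix : ∀ {s n} → PalAt (suc s) n → u s ≢ u (suc s + n) → SameAt 0 (suc s) n
  distinct-neighbours⇒prefix {s} {n} pal u≢ =
    slice≡⇒Agree u 0 u (suc s) n (subst (λ z → slice u 0 z ≡ w) (length-slice u (suc s) n) w-prefix)
    where
      w : Word k
      w = slice u (suc s) n
      left : InL u (u s ∷ w)
      left = s , cong (λ z → slice u s (suc z)) (length-slice u (suc s) n)
      reverse-w·b : reverse (slice u (suc s) (suc n)) ≡ u (suc s + n) ∷ w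
      reverse-w·b = begin
        reverse (slice u (suc s) (suc n))   ≡⟨ cong reverse (slice-suc u (suc s) n) ⟩
        reverse (w ++ [ u (suc s + n) ])    ≡⟨ reverse-++ w [ u (suc s + n) ] ⟩
        u (suc s + n) ∷ reverse w          ≡⟨ cong (u (suc s + n) ∷_) (PalAt⇒reverse (suc s) n pal) ⟩
        u (suc s + n) ∷ w                  ∎
        where open ≡-Reasoning
      right : InL u (u (suc s + n) ∷ w)
      right = subst (InL u) reverse-w·b
        (proj₁ (proj₁ std) _ (suc s , cong (slice u (suc s)) (length-slice u (suc s) (suc n))))
      w-prefix : IsPrefixOfSeq w u
      w-prefix = proj₂ std w (u s , u (suc s + n) , u≢ , left , right)

  module PalindromicClosure {T X ℓ : ℕ} (X+ℓ≡1+T : X + ℓ ≡ suc T) (1≤ℓ : 1 ≤ ℓ) (palT : Pal T)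
           (palSuffix : PalAt X ℓ)
           (longest : ∀ {X' ℓ'} → X' + ℓ' ≡ suc T → PalAt X' ℓ' → ℓ' ≤ ℓ) where

    no-shorter : ∀ {R} → Pal R → T < R → suc T + X ≤ R
    no-shorter palR T<R with m≤n⇒∃[o]m+o≡n T<R
    ... | X' , refl with X ≤? X'
    ...   | yes X≤X' = +-monoʳ-≤ (suc T) X≤X'
    ...   | no X≰X' with m≤n⇒∃[o]m+o≡n (≰⇒> X≰X')
    ...     | d , 1+X'+d≡X =
      ⊥-elim (<⇒≱ (s≤s (m≤n+m ℓ d)) (longest X'+ℓ'≡1+T (PalAt-centre palR (cong (_+ X') X'+ℓ'≡1+T))))
      where
        X'+ℓ'≡1+T : X' + (suc d + ℓ) ≡ suc T
        X'+ℓ'≡1+T = trans reassoc (trans (cong (_+ ℓ) 1+X'+d≡X) X+ℓ≡1+T)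
          where
            reassoc : X' + (suc d + ℓ) ≡ suc X' + d + ℓ
            reassoc = solve (X' ∷ d ∷ ℓ ∷ [])

    -- Otherwise the central palindrome would be a left special factor, hence a prefix, and
    -- u_s ⋯ u_T would be a palindromic suffix longer than ℓ.
    extends : ∀ {s r} → suc s + r ≡ X → PalAt (suc s) (r + (ℓ + r)) → u s ≡ u (suc s + (r + (ℓ + r)))
    extends {s} {r} 1+s+r≡X pal with u s Fin.≟ u (suc s + (r + (ℓ + r)))
    ... | yes e = e
    ... | no u≢ = ⊥-elim (<⇒≱ (s≤s (m≤n+m ℓ r)) (longest s+ℓ'≡1+T (PalAt-fromPositive symmetric)))
      where
        open ≡-Reasoning
        copy : SameAt 0 (suc s) (r + (ℓ + r))
        copy = distinct-neighbours⇒prefix pal u≢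
        palm : Pal (r + (ℓ + r))
        palm = PalAt-transport copy pal
        s+r+ℓ≡T : s + r + ℓ ≡ T
        s+r+ℓ≡T = suc-injective (trans (cong (_+ ℓ) 1+s+r≡X) X+ℓ≡1+T)
        s+ℓ'≡1+T : s + suc (r + ℓ) ≡ suc T
        s+ℓ'≡1+T = trans reassoc (cong suc s+r+ℓ≡T)
          where
            reassoc : s + suc (r + ℓ) ≡ suc (s + r + ℓ)
            reassoc = solve (s ∷ r ∷ ℓ ∷ [])
        symmetric : ∀ e f → suc (e + suc f) ≡ suc (r + ℓ) → u (s + e) ≡ u (s + suc f)
        symmetric e f eq = begin
          u (s + e)            ≡⟨ palT (s + e) f 1+s+e+f≡T ⟩
          u f                  ≡⟨ palm f (r + e) (trans (cong suc (+-comm f (r + e))) 1+r+e+f≡centre) ⟩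
          u (r + e)            ≡⟨ copy (r + e) (subst (r + e <_) 1+r+e+f≡centre (s≤s (m≤m+n (r + e) f))) ⟩
          u (suc s + (r + e))  ≡⟨ pal (r + e) f 1+r+e+f≡centre ⟩
          u (suc s + f)        ≡⟨ cong u (sym (+-suc s f)) ⟩
          u (s + suc f)        ∎
          where
            unfold : ∀ a → suc (a + e + f) ≡ a + (e + suc f)
            unfold a = solve (a ∷ e ∷ f ∷ [])
            e+1+f≡r+ℓ : e + suc f ≡ r + ℓ
            e+1+f≡r+ℓ = suc-injective eq
            1+s+e+f≡T : suc (s + e + f) ≡ T
            1+s+e+f≡T = trans (unfold s) (trans (cong (s +_) e+1+f≡r+ℓ) (trans (sym (+-assoc s r ℓ)) s+r+ℓ≡T))
            1+r+e+f≡centre : suc (r + e + f) ≡ r + (ℓ + r)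
            1+r+e+f≡centre = trans (unfold r) (trans (cong (r +_) e+1+f≡r+ℓ) (cong (r +_) (+-comm r ℓ)))

    closure-PalAt : ∀ r {B} → B + r ≡ X → PalAt B (r + (ℓ + r))
    closure-PalAt zero {B} B+0≡X =
      subst₂ PalAt (sym (trans (sym (+-identityʳ B)) B+0≡X)) (sym (+-identityʳ ℓ)) palSuffix
    closure-PalAt (suc r) {B} B+r≡X = subst (PalAt B) grow (PalAt-extend inner (extends 1+B+r≡X inner))
      where
        1+B+r≡X : suc B + r ≡ X
        1+B+r≡X = trans (sym (+-suc B r)) B+r≡X
        inner : PalAt (suc B) (r + (ℓ + r))
        inner = closure-PalAt r 1+B+r≡X
        grow : suc (suc (r + (ℓ + r))) ≡ suc r + (ℓ + suc r)
        grow = solve (r ∷ ℓ ∷ [])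

    next : Next T (suc T + X)
    next = subst Pal (trans (sym (+-assoc X ℓ X)) (cong (_+ X) X+ℓ≡1+T)) (closure-PalAt X refl) ,
           m≤m+n (suc T) X , no-shorter

  next-palindrome : ∀ {T} → Pal T → ∃ λ E → Next T (suc T + E) × E ≤ T
  next-palindrome {T} palT
    with BoundedSearch.greatest (λ ℓ → PalAt? (suc T ∸ ℓ) ℓ) (suc T) (s≤s z≤n) (PalAt-1 T)
  ... | ℓ , ℓ≤1+T , palSuffix , maximal =
    suc T ∸ ℓ ,
    PalindromicClosure.next (m∸n+n≡m ℓ≤1+T) 1≤ℓ palT palSuffix longest ,
    ∸-monoʳ-≤ (suc T) 1≤ℓ
    where
      1≤ℓ : 1 ≤ ℓ
      1≤ℓ = maximal (s≤s z≤n) (PalAt-1 T)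
      longest : ∀ {X' ℓ'} → X' + ℓ' ≡ suc T → PalAt X' ℓ' → ℓ' ≤ ℓ
      longest {X'} {ℓ'} X'+ℓ'≡1+T pal = maximal (subst (ℓ' ≤_) X'+ℓ'≡1+T (m≤n+m ℓ' X'))
        (subst (λ z → PalAt z ℓ') (sym (trans (cong (_∸ ℓ') (sym X'+ℓ'≡1+T)) (m+n∸n≡m X' ℓ'))) pal)

  -- Justin's formula: if S = T + 1 + D is the first palindromic prefix after T followed by the
  -- same letter as T, then u_D ⋯ u_S is the longest palindromic suffix of u₀ ⋯ u_S, so the
  -- palindromic prefix after S has length 2S − T.
  next-after-return : ∀ {T D S} → suc T + D ≡ S → Pal T → Pal S → u T ≡ u S →
                      (∀ {R} → T < R → R < S → Pal R → u R ≢ u S) → Next S (S + suc D)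
  next-after-return {T} {D} refl palT palS uT≡uS first =
    subst (Next S) (sym (+-suc S D))
      (PalindromicClosure.next D+2+T≡1+S (s≤s z≤n) palS (PalAt-extend palT' uD≡uS) longest)
    where
      S : ℕ
      S = suc T + D
      D+2+T≡1+S : D + suc (suc T) ≡ suc (suc T + D)
      D+2+T≡1+S = solve (D ∷ T ∷ [])
      1+D+T≡S : suc D + T ≡ S
      1+D+T≡S = cong suc (+-comm D T)
      palT' : PalAt (suc D) T
      palT' = Pal-suffix palS palT 1+D+T≡S
      uD≡uS : u D ≡ u (suc D + T)
      uD≡uS = trans (palS D T 1+D+T≡S) (trans uT≡uS (cong u (sym 1+D+T≡S)))
      longest : ∀ {X' ℓ'} → X' + ℓ' ≡ suc S → PalAt X' ℓ' → ℓ' ≤ suc (suc T)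
      longest {ℓ' = zero} _ _ = z≤n
      longest {ℓ' = suc zero} _ _ = s≤s z≤n
      longest {X'} {suc (suc R)} X'+ℓ'≡1+S pal with R ≤? T
      ... | yes R≤T = s≤s (s≤s R≤T)
      ... | no R≰T = ⊥-elim (uncurry (first (≰⇒> R≰T) R<S) (Pal-suffix-mirror palS pal X'+1+R≡S))
        where
          X'+1+R≡S : X' + suc R ≡ S
          X'+1+R≡S = suc-injective (trans (sym (+-suc X' (suc R))) X'+ℓ'≡1+S)
          R<S : R < S
          R<S = subst (suc R ≤_) X'+1+R≡S (m≤n+m (suc R) X')

  ends-before-next : ∀ {T n c} → (∀ {j} → j ≤ n → Pal j → j ≤ T) → Next T c → n < c
  ends-before-next maximal (palC , T<C , _) = ≰⇒> λ c≤n → <⇒≱ T<C (maximal c≤n palC)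

  -- Let T be the longest palindromic prefix of u₀ ⋯ u_{i+l}. An occurrence at i not covering T lies
  -- in the palindromic prefix after T, to the right of T, and reflecting it there moves it left.
  straddles-or-mirrors : ∀ i l → (∃ λ T → Straddles T i (suc l)) ⊎ (∃ λ i' → i' < i × SameAt i' i (suc l))
  straddles-or-mirrors i l = case BoundedSearch.greatest (PalAt? 0) (i + l) z≤n Pal-0 of λ where
    (T , T≤i+l , palT , maximal) → case next-palindrome palT of λ where
      (E , nextT@(palC , _) , E≤T) →
        let end≤C = subst (_≤ suc T + E) (sym (+-suc i l)) (ends-before-next maximal nextT)
        in case i ≤? T of λ where
          (yes i≤T) → inj₁ (T , palT , (suc T + E , nextT , end≤C) , i≤T ,
                            subst (T <_) (sym (+-suc i l)) (s≤s T≤i+l))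
          (no i≰T) → case mirror-occurrence palT palC E≤T (≰⇒> i≰T) end≤C of λ where
            (i' , i'+1+E≡i , same) → inj₂ (i' , subst (i' <_) i'+1+E≡i (m<m+n i' z<s) , same)

  descend : ∀ {i} → Acc _<_ i → ∀ l →
            ∃ λ T → ∃ λ i' → Straddles T i' (suc l) × i' ≤ i × SameAt i' i (suc l)
  descend {i} (acc smaller) l = case straddles-or-mirrors i l of λ where
    (inj₁ (T , straddle)) → T , i , straddle , ≤-refl , λ _ _ → refl
    (inj₂ (i' , i'<i , same)) → case descend (smaller i'<i) l of λ where
      (T , i'' , straddle , i''≤i' , same') →
        T , i'' , straddle , ≤-trans i''≤i' (<⇒≤ i'<i) , SameAt-trans same' same

  -- S is the first palindromic prefix after T followed by the letter u_M. By Justin's formula S − T is a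
  -- period of the palindromic prefix after S, so shifting by S − T makes the occurrence straddle S.
  ascend : ∀ {M T i l} → Pal M → u T ≡ u M → T ≤ M → Acc _<_ (M ∸ T) → Straddles T i l →
           ∃ λ i' → Straddles M i' l × SameAt i' i l
  ascend {M} {T} {i} {l} palM uT≡uM T≤M (acc smaller) straddle@(palT , (c , nextT , i+l≤c) , i≤T , T<i+l) =
    case T ≟ M of λ where
      (yes refl) → i , straddle , λ _ _ → refl
      (no T≢M) → climb (BoundedSearch.least (λ S → (T <? S) ×-dec (PalAt? 0 S ×-dec (u S Fin.≟ u M)))
                                             (≤∧≢⇒< T≤M T≢M , palM , refl))
    where
      climb : (∃ λ S → (T < S × Pal S × u S ≡ u M) × S ≤ M ×
                        (∀ {R} → R < S → ¬ (T < R × Pal R × u R ≡ u M))) →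
              ∃ λ i' → Straddles M i' l × SameAt i' i l
      climb (S , (T<S , palS , uS≡uM) , S≤M , first) =
        let D , 1+T+D≡S = m≤n⇒∃[o]m+o≡n T<S
            nextS = next-after-return 1+T+D≡S palT palS (trans uT≡uM (sym uS≡uM))
                      λ T<R R<S palR uR≡uS → first R<S (T<R , palR , trans uR≡uS uS≡uM)
            i'≤S , S<end , end≤ , same = shift-occurrence palS (proj₁ nextS) (trans (+-suc T D) 1+T+D≡S)
                                           i≤T T<i+l (≤-trans i+l≤c (proj₂ (proj₂ nextT) palS T<S))
            i'' , straddleM , same' = ascend palM uS≡uM S≤M (smaller (∸-monoʳ-< T<S S≤M))
                                        (palS , (S + suc D , nextS , end≤) , i'≤S , S<end)
        in i'' , straddleM , SameAt-trans same' same

module PalindromicPrefix {k : ℕ} (u : Seq k) (std : StandardEpisturmian u) (v : Word k)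
                         (v-prefix : IsPrefixOfSeq v u) (v-pal : IsPalindrome v) where
  open Palindromes u
  open StandardEpisturmianPalindromes u std

  N : ℕ
  N = length v

  sub≡slice : ∀ i l → i + l ≤ N → sub v i l ≡ slice u i l
  sub≡slice i l i+l≤N = let d , i+l+d≡N = m≤n⇒∃[o]m+o≡n i+l≤N in begin
    take l (drop i v)                          ≡⟨ cong (λ w → take l (drop i w)) (sym v-prefix) ⟩
    take l (drop i (slice u 0 N))              ≡⟨ cong (λ z → take l (drop i (slice u 0 z)))
                                                       (sym (trans (sym (+-assoc i l d)) i+l+d≡N)) ⟩
    take l (drop i (slice u 0 (i + (l + d))))  ≡⟨ cong (take l) (drop-slice u 0 i (l + d)) ⟩
    take l (slice u i (l + d))                 ≡⟨ take-slice u i l d ⟩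
    slice u i l                                ∎
    where open ≡-Reasoning

  Pal-N : Pal N
  Pal-N = reverse⇒PalAt 0 N (subst (λ w → reverse w ≡ w) (sym v-prefix) v-pal)

  ∈v⁺ : ∀ {t} → t < N → u t ∈ₗ v
  ∈v⁺ t<N = subst (_ ∈ₗ_) v-prefix (∈-slice⁺ u 0 N t<N)

  ∈v⁻ : ∀ {a} → a ∈ₗ v → ∃ λ t → t < N × u t ≡ a
  ∈v⁻ a∈v = ∈-slice⁻ u 0 N (subst (_ ∈ₗ_) (sym v-prefix) a∈v)

  PalBefore : Fin k → ℕ → Set
  PalBefore a j = Pal j × u j ≡ a × j < N

  snoc⇔ : ∀ {a j} → j < N → (take (suc j) v ≡ take j v ++ [ a ]) ⇔ (u j ≡ a)
  snoc⇔ {a} {j} j<N = mk⇔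
    (λ e → ∷ʳ-injectiveʳ (slice u 0 j) _
      (trans (sym (slice-suc u 0 j)) (trans (sym (sub≡slice 0 (suc j) j<N)) (trans e (cong (_++ [ a ]) take-j)))))
    (λ uj≡a → trans (sub≡slice 0 (suc j) j<N)
      (trans (slice-suc u 0 j) (cong₂ (λ w b → w ++ [ b ]) (sym take-j) uj≡a)))
    where
      take-j : take j v ≡ slice u 0 j
      take-j = sub≡slice 0 j (<⇒≤ j<N)

  palindrome⇔ : ∀ {j} → j ≤ N → (reverse (take j v) ≡ take j v) ⇔ Pal j
  palindrome⇔ {j} j≤N = mk⇔
    (λ e → reverse⇒PalAt 0 j (subst (λ w → reverse w ≡ w) (sub≡slice 0 j j≤N) e))
    (λ pal → subst (λ w → reverse w ≡ w) (sym (sub≡slice 0 j j≤N)) (PalAt⇒reverse 0 j pal))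

  mCand-cases : ∀ a j → j < N → mCand v a j ≡ 0 ⊎ (mCand v a j ≡ j × PalBefore a j)
  mCand-cases a j j<N with take (suc j) v ≟w (take j v ++ [ a ]) | reverse (take j v) ≟w take j v
  ... | yes snoc | yes pal =
    inj₂ (refl , Equivalence.to (palindrome⇔ (<⇒≤ j<N)) pal , Equivalence.to (snoc⇔ j<N) snoc , j<N)
  ... | yes _ | no _ = inj₁ refl
  ... | no _ | _ = inj₁ refl

  mCand-PalBefore : ∀ {a j} → PalBefore a j → mCand v a j ≡ j
  mCand-PalBefore {a} {j} (pal , uj≡a , j<N)
    rewrite dec-true (take (suc j) v ≟w (take j v ++ [ a ])) (Equivalence.from (snoc⇔ j<N) uj≡a)
          | dec-true (reverse (take j v) ≟w take j v) (Equivalence.from (palindrome⇔ (<⇒≤ j<N)) pal) = refl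

  PalBefore⇒≤m : ∀ {a j} → PalBefore a j → j ≤ m v a
  PalBefore⇒≤m {a} {j} before@(_ , _ , j<N) =
    subst (_≤ m v a) (mCand-PalBefore before) (x≤foldr⊔ _ (∈-map⁺ (mCand v a) (∈-upTo⁺ j<N)))

  PalBefore-m≡0 : ∀ {a j} → PalBefore a j → m v a ≡ 0 → PalBefore a (m v a)
  PalBefore-m≡0 {a} {j} before m≡0 = subst (PalBefore a) (sym m≡0)
    (subst (PalBefore a) (n≤0⇒n≡0 (subst (j ≤_) m≡0 (PalBefore⇒≤m before))) before)

  PalBefore-m : ∀ {a j} → PalBefore a j → PalBefore a (m v a)
  PalBefore-m {a} before with foldr⊔-sel (map (mCand v a) (upTo N))
  ... | inj₁ m≡0 = PalBefore-m≡0 before m≡0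
  ... | inj₂ m∈ with ∈-map⁻ (mCand v a) m∈
  ...   | j , j∈ , m≡cand with mCand-cases a j (∈-upTo⁻ j∈)
  ...     | inj₁ cand≡0 = PalBefore-m≡0 before (trans m≡cand cand≡0)
  ...     | inj₂ (cand≡j , before') = subst (PalBefore a) (sym (trans m≡cand cand≡j)) before'

  ∈Γ⁺ : ∀ {a} → a ∈ₗ v → (p : Fin N) → m v a ≡ toℕ p → p ∈ Γ v
  ∈Γ⁺ a∈v p m≡p = lookup⇒[]= p (Γ v)
    (trans (lookup∘tabulate _ p) (Equivalence.to T-≡ (any⁺ _ (lose a∈v (≡⇒≡ᵇ (m v _) (toℕ p) m≡p)))))

  ∈Γ⁻ : ∀ {p} → p ∈ Γ v → ∃ λ a → a ∈ₗ v × m v a ≡ toℕ p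
  ∈Γ⁻ {p} p∈Γ
    with find (any⁻ _ v (Equivalence.from T-≡ (trans (sym (lookup∘tabulate _ p)) ([]=⇒lookup p∈Γ))))
  ... | a , a∈v , m≡p = a , a∈v , ≡ᵇ⇒≡ (m v a) (toℕ p) m≡p

  straddling-m : ∀ i l → i + suc l ≤ N → ∃ λ a → a ∈ₗ v × ∃ λ i' →
                 i' ≤ m v a × m v a < i' + suc l × i' + suc l ≤ N × SameAt i' i (suc l)
  straddling-m i l end≤N = case descend (<-wellFounded i) l of λ where
    (T , i₁ , straddle@(palT , _ , _ , T<end₁) , i₁≤i , same₁) →
      let T<N = <-≤-trans T<end₁ (≤-trans (+-monoˡ-≤ (suc l) i₁≤i) end≤N)
          before = palT , refl , T<N
          palM , uM≡uT , M<N = PalBefore-m before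
      in case ascend palM (sym uM≡uT) (PalBefore⇒≤m before) (<-wellFounded _) straddle of λ where
        (i₂ , (_ , (_ , nextM , end≤c) , i₂≤M , M<end) , same₂) →
          u T , ∈v⁺ T<N , i₂ , i₂≤M , M<end ,
          ≤-trans end≤c (proj₂ (proj₂ nextM) Pal-N M<N) , SameAt-trans same₂ same₁

  attractor : IsStringAttractor v (Γ v)
  attractor i (suc l) _ end≤N = case straddling-m i l end≤N of λ where
    (a , a∈v , i' , i'≤M , M<end , end'≤N , same) →
      let M<N = <-≤-trans M<end end'≤N
          M = fromℕ< M<N
      in i' , end'≤N ,
         trans (sub≡slice i' (suc l) end'≤N)
           (trans (Agree⇒slice≡ u i' u i (suc l) same) (sym (sub≡slice i (suc l) end≤N))) ,
         M , ∈Γ⁺ a∈v M (sym (toℕ-fromℕ< M<N)) ,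
         subst (i' ≤_) (sym (toℕ-fromℕ< M<N)) i'≤M , subst (_< i' + suc l) (sym (toℕ-fromℕ< M<N)) M<end

  letter-PalBefore : ∀ {a} → a ∈ₗ v → ∃ λ j → PalBefore a j
  letter-PalBefore a∈v with ∈v⁻ a∈v
  ... | t , t<N , ut≡a = case descend (<-wellFounded t) 0 of λ where
    (T , i' , (palT , _ , i'≤T , T<i'+1) , i'≤t , same) →
      let T≡i' = ≤-antisym (m<1+n⇒m≤n (subst (T <_) (+-comm i' 1) T<i'+1)) i'≤T
      in T , palT ,
         trans (cong u (trans T≡i' (sym (+-identityʳ i')))) (trans (same 0 z<s) (trans (cong u (+-identityʳ t)) ut≡a)) ,
         ≤-<-trans (subst (_≤ t) (sym T≡i') i'≤t) t<N

  minimal : ∀ (Δ : Subset N) → IsStringAttractor v Δ → ∣ Γ v ∣ ≤ ∣ Δ ∣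
  minimal Δ attracts = card≤card-image (Γ v) Δ (λ q → m v (u (toℕ q))) covered
    where
      covered : ∀ {p} → p ∈ Γ v → ∃ λ q → q ∈ Δ × m v (u (toℕ q)) ≡ toℕ p
      covered {p} p∈Γ =
        let a , a∈v , m≡p = ∈Γ⁻ p∈Γ
            _ , up≡a , _ = PalBefore-m (proj₂ (letter-PalBefore a∈v))
            p+1≤N = subst (_≤ N) (+-comm 1 (toℕ p)) (toℕ<n p)
            i' , i'+1≤N , sub≡ , q , q∈Δ , i'≤q , q<i'+1 = attracts (toℕ p) 1 (s≤s z≤n) p+1≤N
            q≡i' = ≤-antisym (m<1+n⇒m≤n (subst (toℕ q <_) (+-comm i' 1) q<i'+1)) i'≤q
            ui'≡up = ∷-injectiveˡ (trans (sym (sub≡slice i' 1 i'+1≤N))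
                                          (trans sub≡ (sub≡slice (toℕ p) 1 p+1≤N)))
        in q , q∈Δ , trans (cong (λ z → m v (u z)) q≡i')
                       (trans (cong (m v) (trans ui'≡up (trans (cong u (sym m≡p)) up≡a))) m≡p)

theorem2 : ∀ {k} (u : Seq k) (v : Word k) → StandardEpisturmian u →
    1 ≤ length v → IsPrefixOfSeq v u → IsPalindrome v →
    IsStringAttractor v (Γ v) ×
    (∀ (Δ : Subset (length v)) → IsStringAttractor v Δ → ∣ Γ v ∣ ≤ ∣ Δ ∣)
theorem2 u v std _ v-prefix v-pal = attractor , minimal
  where open PalindromicPrefix u std v v-prefix v-pal
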